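{- Let $n\ge 2$ and let $P$ be a set of $2n$ points in regular wheel configuration. If a plane spanning tree $T$ on $P$ has exactly $k$ radial edges with $k<n$, then $T$ has at least two boundary edges.
   Context: A set $P$ of $2n$ points is in regular wheel configuration if $2n-1$ of its points are the vertices of a regular $(2n-1)$-gon inscribed in a circle $C$ and the remaining point $x$ is the centre of $C$. Edges are straight-line segments between points of $P$; a plane spanning tree on $P$ is a spanning tree of the complete geometric graph on $P$ whose edges pairwise do not cross (meet only at common endpoints). A boundary edge is an edge joining two points consecutive on $C$; a radial edge is an edge incident to $x$. -}

module Defs where

open import Data.Nat using (ℕ; zero; suc; _+_; _*_; _∸_; _<_; _≤_; ∣_-_∣)
open import Data.Nat.Properties using (_<?_)
open import Data.Fin using (Fin; toℕ; fromℕ<)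
open import Data.List using (List; []; _∷_; _++_; [_]; length; map; allFin)
open import Data.Nat.ListAction using (sum)
open import Data.List.Relation.Unary.Unique.Propositional using (Unique)
open import Data.Bool using (Bool; true; false; if_then_else_)
open import Data.Product using (Σ; _×_)
open import Data.Sum using (_⊎_)
open import Data.Empty using (⊥)
open import Data.Unit using (⊤)
open import Relation.Nullary using (¬_; yes; no)
open import Relation.Binary.PropositionalEquality using (_≡_; _≢_)

-- Points of a regular wheel configuration with m rim points:
-- the centre x (ctr) and the vertices rim 0, …, rim (m-1) of a regular
-- m-gon, numbered in cyclic (counter-clockwise) order.
data Pt (m : ℕ) : Set where
  ctr : Pt m
  rim : Fin m → Pt m

nextFin : {m : ℕ} → Fin m → Fin m
nextFin {suc k} i with suc (toℕ i) <? suc k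
... | yes p = fromℕ< p
... | no _  = Fin.zero

Btw : ℕ → ℕ → ℕ → Set
Btw a b x = (a < x × x < b) ⊎ (b < x × x < a)

-- Chords ab and cd of the (convex) regular m-gon cross
-- iff their endpoints are distinct and interleave in cyclic order.
ChordCross : ℕ → ℕ → ℕ → ℕ → Set
ChordCross a b c d =
  a ≢ c × a ≢ d × b ≢ c × b ≢ d ×
  ((Btw a b c × ¬ Btw a b d) ⊎ (¬ Btw a b c × Btw a b d))

-- The radial segment from the centre to vertex c crosses chord ab
-- (m odd, so no chord passes through the centre) iff c ∉ {a,b} and
-- c lies strictly inside the minor arc cut off by ab.
RadCross : ℕ → ℕ → ℕ → ℕ → Set
RadCross m c a b =
  c ≢ a × c ≢ b ×
  ((2 * ∣ a - b ∣ < m × Btw a b c) ⊎ (m < 2 * ∣ a - b ∣ × ¬ Btw a b c))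

-- The straight-line segments pq and rs cross (meet in a point that is
-- not a common endpoint).
Crosses : {m : ℕ} → Pt m → Pt m → Pt m → Pt m → Set
Crosses {m} (rim a) (rim b) (rim c) (rim d) = ChordCross (toℕ a) (toℕ b) (toℕ c) (toℕ d)
Crosses {m} ctr (rim c) (rim a) (rim b) = RadCross m (toℕ c) (toℕ a) (toℕ b)
Crosses {m} (rim c) ctr (rim a) (rim b) = RadCross m (toℕ c) (toℕ a) (toℕ b)
Crosses {m} (rim a) (rim b) ctr (rim c) = RadCross m (toℕ c) (toℕ a) (toℕ b)
Crosses {m} (rim a) (rim b) (rim c) ctr = RadCross m (toℕ c) (toℕ a) (toℕ b)
Crosses _ _ _ _ = ⊥

record Graph (m : ℕ) : Set where
  field
    E     : Pt m → Pt m → Bool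
    sym   : ∀ p q → E p q ≡ E q p
    irrefl : ∀ p → E p p ≡ false
open Graph public

Adj : {m : ℕ} → Graph m → Pt m → Pt m → Set
Adj G p q = E G p q ≡ true

data Walk {m : ℕ} (G : Graph m) : Pt m → Pt m → Set where
  here : ∀ {u} → Walk G u u
  step : ∀ {u v w} → Adj G u v → Walk G v w → Walk G u w

Connected : {m : ℕ} → Graph m → Set
Connected G = ∀ u v → Walk G u v

PathAdj : {m : ℕ} → Graph m → List (Pt m) → Set
PathAdj G [] = ⊤
PathAdj G (x ∷ []) = ⊤
PathAdj G (x ∷ y ∷ r) = Adj G x y × PathAdj G (y ∷ r)

HasCycle : {m : ℕ} → Graph m → Set
HasCycle {m} G = Σ (Pt m) λ v → Σ (List (Pt m)) λ rest →
  2 ≤ length rest × Unique (v ∷ rest) × PathAdj G ((v ∷ rest) ++ [ v ])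

IsSpanningTree : {m : ℕ} → Graph m → Set
IsSpanningTree G = Connected G × ¬ HasCycle G

IsPlane : {m : ℕ} → Graph m → Set
IsPlane G = ∀ p q r s → Adj G p q → Adj G r s → ¬ Crosses p q r s

b2n : Bool → ℕ
b2n b = if b then 1 else 0

radialCount : {m : ℕ} → Graph m → ℕ
radialCount {m} G = sum (map (λ i → b2n (E G ctr (rim i))) (allFin m))

boundaryCount : {m : ℕ} → Graph m → ℕ
boundaryCount {m} G = sum (map (λ i → b2n (E G (rim i) (rim (nextFin i)))) (allFin m))

module Submission where

-- Label the rim 0, …, 2h, so n = h + 1. In a connected plane graph every rim
-- vertex has a neighbour. A chord spanning at most h steps has a boundary edge
-- on its short side, by induction on its length: the vertex next to one endpoint
-- can be neither radial nor joined to a vertex outside the arc, so it is joined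
-- to that endpoint or spans a shorter chord. If at most one boundary edge
-- exists, say between offsets h and h + 1 from some vertex b, every chord
-- therefore straddles it. Then the vertices at offsets u and h + 1 + u (u < h)
-- cannot both have rim neighbours, as their chords would cross, so one of them
-- is radial; a path from offset h to the centre yields one more radial edge.
-- Hence there are at least n radial edges.

open import Defs
open import Data.Nat using (ℕ; _≤_; _<_; _*_; _∸_)
open import Relation.Binary.PropositionalEquality using (_≡_)

open import Data.Bool using (true)
import Data.Bool.Properties as Bool
open import Data.Empty using (⊥; ⊥-elim)
open import Data.Fin as Fin using (Fin; toℕ; fromℕ<)
open import Data.Fin.Patterns using (0F)
open import Data.Fin.Properties using (toℕ-injective; toℕ-fromℕ<; toℕ<n; any?)
open import Data.List using (tabulate; map; allFin)
open import Data.List.Properties using (map-tabulate)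
open import Data.Nat using (zero; suc; _+_; ∣_-_∣; z≤n; s≤s)
open import Data.Nat.DivMod using (_%_; _mod_; m%n<n; m<n⇒m%n≡m; m%n%n≡m%n; %-distribˡ-+; [m+n]%n≡m%n; n%n≡0; m≤n⇒[n∸m]%m≡n%m)
open import Data.Nat.Induction using (<-wellFounded; Acc; acc)
open import Data.Nat.ListAction using (sum)
open import Data.Nat.Properties
open import Algebra.Properties.CommutativeSemigroup +-commutativeSemigroup using (xy∙z≈xz∙y; x∙yz≈y∙xz)
open import Data.Product using (∃-syntax; _×_; _,_)
import Data.Sum as Sum
open import Data.Sum using (_⊎_; inj₁; inj₂; [_,_]′)
open import Function using (_∘_; id)
open import Relation.Binary.Definitions using (tri<; tri≈; tri>)
open import Relation.Binary.PropositionalEquality as ≡ using (refl; trans; cong; cong₂; subst; subst₂; _≢_; module ≡-Reasoning)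
open import Relation.Nullary using (¬_; yes; no)
open import Relation.Nullary.Decidable using (¬?; _×-dec_)
open import Relation.Unary using (Decidable)

sumBelow : (ℕ → ℕ) → ℕ → ℕ
sumBelow f zero    = 0
sumBelow f (suc k) = sumBelow f k + f k

sumBelow-cong : ∀ {f g} k → (∀ x → f x ≡ g x) → sumBelow f k ≡ sumBelow g k
sumBelow-cong zero    f≗g = refl
sumBelow-cong (suc k) f≗g = cong₂ _+_ (sumBelow-cong k f≗g) (f≗g k)

sumBelow-+ : ∀ f a c → sumBelow f (a + c) ≡ sumBelow f a + sumBelow (λ x → f (a + x)) c
sumBelow-+ f a zero    = trans (cong (sumBelow f) (+-identityʳ a)) (≡.sym (+-identityʳ _))
sumBelow-+ f a (suc c) = begin
  sumBelow f (a + suc c)                                 ≡⟨ cong (sumBelow f) (+-suc a c) ⟩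
  sumBelow f (a + c) + f (a + c)                         ≡⟨ cong (_+ f (a + c)) (sumBelow-+ f a c) ⟩
  sumBelow f a + sumBelow (λ x → f (a + x)) c + f (a + c) ≡⟨ +-assoc (sumBelow f a) _ _ ⟩
  sumBelow f a + sumBelow (λ x → f (a + x)) (suc c)      ∎
  where open ≡-Reasoning

sumBelow-distrib : ∀ f g k → sumBelow (λ x → f x + g x) k ≡ sumBelow f k + sumBelow g k
sumBelow-distrib f g zero    = refl
sumBelow-distrib f g (suc k) = begin
  sumBelow (λ x → f x + g x) k + (f k + g k)       ≡⟨ cong (_+ (f k + g k)) (sumBelow-distrib f g k) ⟩
  sumBelow f k + sumBelow g k + (f k + g k)        ≡⟨ +-assoc (sumBelow f k) _ _ ⟩
  sumBelow f k + (sumBelow g k + (f k + g k))      ≡⟨ cong (sumBelow f k +_) (x∙yz≈y∙xz (sumBelow g k) (f k) (g k)) ⟩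
  sumBelow f k + (f k + (sumBelow g k + g k))      ≡⟨ +-assoc (sumBelow f k) (f k) _ ⟨
  sumBelow f k + f k + (sumBelow g k + g k)        ∎
  where open ≡-Reasoning

sumBelow-rotate : ∀ f a c → (∀ x → f (a + c + x) ≡ f x) →
                  sumBelow (λ x → f (a + x)) (a + c) ≡ sumBelow f (a + c)
sumBelow-rotate f a c periodic = begin
  sumBelow (λ x → f (a + x)) (a + c)                                 ≡⟨ cong (sumBelow (λ x → f (a + x))) (+-comm a c) ⟩
  sumBelow (λ x → f (a + x)) (c + a)                                 ≡⟨ sumBelow-+ (λ x → f (a + x)) c a ⟩
  sumBelow (λ x → f (a + x)) c + sumBelow (λ x → f (a + (c + x))) a  ≡⟨ cong (sumBelow (λ x → f (a + x)) c +_) (sumBelow-cong a wrap) ⟩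
  sumBelow (λ x → f (a + x)) c + sumBelow f a                        ≡⟨ +-comm _ (sumBelow f a) ⟩
  sumBelow f a + sumBelow (λ x → f (a + x)) c                        ≡⟨ sumBelow-+ f a c ⟨
  sumBelow f (a + c)                                                 ∎
  where
  open ≡-Reasoning
  wrap : ∀ x → f (a + (c + x)) ≡ f x
  wrap x = trans (cong f (≡.sym (+-assoc a c x))) (periodic x)

sumBelow-≥ : ∀ f k → (∀ {u} → u < k → 1 ≤ f u) → k ≤ sumBelow f k
sumBelow-≥ f zero    _        = z≤n
sumBelow-≥ f (suc k) positive = subst (_≤ sumBelow f k + f k) (+-comm k 1)
  (+-mono-≤ (sumBelow-≥ f k (λ u<k → positive (m<n⇒m<1+n u<k))) (positive ≤-refl))

sumBelow-> : ∀ f k → (∀ {u} → u < k → 1 ≤ f u) → ∀ {w} → w < k → 2 ≤ f w → suc k ≤ sumBelow f k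
sumBelow-> f (suc k) positive {w} w<1+k 2≤fw with w ≟ k
... | yes refl = subst (_≤ sumBelow f k + f k) (+-comm k 2)
  (+-mono-≤ (sumBelow-≥ f k (λ u<k → positive (m<n⇒m<1+n u<k))) 2≤fw)
... | no w≢k = subst (_≤ sumBelow f k + f k) (+-comm (suc k) 1)
  (+-mono-≤ (sumBelow-> f k (λ u<k → positive (m<n⇒m<1+n u<k)) (≤∧≢⇒< (≤-pred w<1+k) w≢k) 2≤fw) (positive ≤-refl))

-- The pairs {u, h + 1 + u} with u < h, together with h, partition 0, …, 2h.
sumBelow-opposite-pairs : ∀ f h → (∀ {u} → u < h → 1 ≤ f u + f (suc h + u)) →
  (∃[ w ] w < h × 2 ≤ f w + f (suc h + w)) ⊎ 1 ≤ f h →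
  suc h ≤ sumBelow f (suc (h + h))
sumBelow-opposite-pairs f h pair≥1 extra = subst (suc h ≤_) (≡.sym split) bound
  where
  pairs = λ u → f u + f (suc h + u)
  split : sumBelow f (suc h + h) ≡ sumBelow pairs h + f h
  split = begin
    sumBelow f (suc h + h)                                    ≡⟨ sumBelow-+ f (suc h) h ⟩
    sumBelow f h + f h + sumBelow (λ u → f (suc h + u)) h     ≡⟨ xy∙z≈xz∙y (sumBelow f h) (f h) _ ⟩
    sumBelow f h + sumBelow (λ u → f (suc h + u)) h + f h     ≡⟨ cong (_+ f h) (sumBelow-distrib f _ h) ⟨
    sumBelow pairs h + f h                                    ∎
    where open ≡-Reasoning
  bound : suc h ≤ sumBelow pairs h + f h
  bound = [ (λ (w , w<h , 2≤pair) → ≤-trans (sumBelow-> pairs h pair≥1 w<h 2≤pair) (m≤m+n _ (f h)))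
          , (λ 1≤fh → subst (_≤ sumBelow pairs h + f h) (+-comm h 1) (+-mono-≤ (sumBelow-≥ pairs h pair≥1) 1≤fh))
          ]′ extra

sum-tabulate : ∀ {m} (g : Fin m → ℕ) (f : ℕ → ℕ) → (∀ i → g i ≡ f (toℕ i)) →
               sum (tabulate g) ≡ sumBelow f m
sum-tabulate {zero}  g f g≗f = refl
sum-tabulate {suc m} g f g≗f = begin
  g 0F + sum (tabulate (g ∘ Fin.suc))        ≡⟨ cong₂ _+_ (g≗f 0F) (sum-tabulate (g ∘ Fin.suc) (f ∘ suc) (g≗f ∘ Fin.suc)) ⟩
  f 0 + sumBelow (f ∘ suc) m                 ≡⟨ sumBelow-+ f 1 m ⟨
  sumBelow f (suc m)                         ∎
  where open ≡-Reasoning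

sum-tabulate-≥ : ∀ {m} (g : Fin m → ℕ) i → g i ≤ sum (tabulate g)
sum-tabulate-≥ g 0F          = m≤m+n (g 0F) _
sum-tabulate-≥ g (Fin.suc i) = ≤-trans (sum-tabulate-≥ (g ∘ Fin.suc) i) (m≤n+m _ (g 0F))

sum-tabulate-≥-pair : ∀ {m} (g : Fin m → ℕ) {i j} → i ≢ j → g i + g j ≤ sum (tabulate g)
sum-tabulate-≥-pair g {0F}        {0F}        0≢0 = ⊥-elim (0≢0 refl)
sum-tabulate-≥-pair g {0F}        {Fin.suc j} _   = +-monoʳ-≤ (g 0F) (sum-tabulate-≥ (g ∘ Fin.suc) j)
sum-tabulate-≥-pair g {Fin.suc i} {0F}        _   =
  subst (_≤ sum (tabulate g)) (+-comm (g 0F) _) (+-monoʳ-≤ (g 0F) (sum-tabulate-≥ (g ∘ Fin.suc) i))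
sum-tabulate-≥-pair g {Fin.suc i} {Fin.suc j} i≢j =
  ≤-trans (sum-tabulate-≥-pair (g ∘ Fin.suc) (i≢j ∘ cong Fin.suc)) (m≤n+m _ (g 0F))

sum-map-allFin : ∀ {m} (g : Fin m → ℕ) → sum (map g (allFin m)) ≡ sum (tabulate g)
sum-map-allFin g = cong sum (map-tabulate id g)

btw-↑ : ∀ {a b x} → a < x → x < b → Btw a b x
btw-↑ a<x x<b = inj₁ (a<x , x<b)

btw-↓ : ∀ {a b x} → b < x → x < a → Btw a b x
btw-↓ b<x x<a = inj₂ (b<x , x<a)

¬btw-below : ∀ {a b x} → x < a → x < b → ¬ Btw a b x
¬btw-below x<a x<b (inj₁ (a<x , _)) = <-asym x<a a<x
¬btw-below x<a x<b (inj₂ (b<x , _)) = <-asym x<b b<x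

¬btw-above : ∀ {a b x} → a < x → b < x → ¬ Btw a b x
¬btw-above a<x b<x (inj₁ (_ , x<b)) = <-asym b<x x<b
¬btw-above a<x b<x (inj₂ (_ , x<a)) = <-asym a<x x<a

module Rotation (m : ℕ) where

  M : ℕ
  M = suc m

  infixl 6 _⊕_
  _⊕_ : Fin M → ℕ → Fin M
  b ⊕ x = (toℕ b + x) mod M

  label : Fin M → ℕ → ℕ
  label b x = toℕ (b ⊕ x)

  toℕ-⊕ : ∀ b x → label b x ≡ (toℕ b + x) % M
  toℕ-⊕ b x = toℕ-fromℕ< (m%n<n (toℕ b + x) M)

  label-unwrapped : ∀ b {x} → toℕ b + x < M → label b x ≡ toℕ b + x
  label-unwrapped b {x} lt = trans (toℕ-⊕ b x) (m<n⇒m%n≡m lt)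

  label-wrapped : ∀ b {x} → x < M → M ≤ toℕ b + x → label b x + M ≡ toℕ b + x
  label-wrapped b {x} x<M M≤ = begin
    label b x + M                ≡⟨ cong (_+ M) (toℕ-⊕ b x) ⟩
    (toℕ b + x) % M + M          ≡⟨ cong (_+ M) (m≤n⇒[n∸m]%m≡n%m M≤) ⟨
    (toℕ b + x ∸ M) % M + M      ≡⟨ cong (_+ M) (m<n⇒m%n≡m (m<n+o⇒m∸n<o _ M (+-mono-< (toℕ<n b) x<M))) ⟩
    toℕ b + x ∸ M + M            ≡⟨ m∸n+n≡m M≤ ⟩
    toℕ b + x                    ∎
    where open ≡-Reasoning

  %-absorbˡ : ∀ a y → (a % M + y) % M ≡ (a + y) % M
  %-absorbˡ a y = begin
    (a % M + y) % M          ≡⟨ %-distribˡ-+ (a % M) y M ⟩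
    (a % M % M + y % M) % M  ≡⟨ cong (λ z → (z + y % M) % M) (m%n%n≡m%n a M) ⟩
    (a % M + y % M) % M      ≡⟨ %-distribˡ-+ a y M ⟨
    (a + y) % M              ∎
    where open ≡-Reasoning

  ⊕-+ : ∀ b x y → b ⊕ x ⊕ y ≡ b ⊕ (x + y)
  ⊕-+ b x y = toℕ-injective (begin
    label (b ⊕ x) y          ≡⟨ toℕ-⊕ (b ⊕ x) y ⟩
    (label b x + y) % M      ≡⟨ cong (λ z → (z + y) % M) (toℕ-⊕ b x) ⟩
    ((toℕ b + x) % M + y) % M ≡⟨ %-absorbˡ (toℕ b + x) y ⟩
    (toℕ b + x + y) % M      ≡⟨ cong (_% M) (+-assoc (toℕ b) x y) ⟩
    (toℕ b + (x + y)) % M    ≡⟨ toℕ-⊕ b (x + y) ⟨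
    label b (x + y)          ∎)
    where open ≡-Reasoning

  ⊕-identityʳ : ∀ b → b ⊕ 0 ≡ b
  ⊕-identityʳ b = toℕ-injective (trans (label-unwrapped b b+0<M) (+-identityʳ (toℕ b)))
    where
    b+0<M : toℕ b + 0 < M
    b+0<M = subst (_< M) (≡.sym (+-identityʳ (toℕ b))) (toℕ<n b)

  ⊕-M : ∀ b → b ⊕ M ≡ b
  ⊕-M b = toℕ-injective (begin
    label b M        ≡⟨ toℕ-⊕ b M ⟩
    (toℕ b + M) % M  ≡⟨ [m+n]%n≡m%n (toℕ b) M ⟩
    toℕ b % M        ≡⟨ m<n⇒m%n≡m (toℕ<n b) ⟩
    toℕ b            ∎)
    where open ≡-Reasoning

  ⊕-periodic : ∀ b x → b ⊕ (M + x) ≡ b ⊕ x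
  ⊕-periodic b x = begin
    b ⊕ (M + x)  ≡⟨ ⊕-+ b M x ⟨
    b ⊕ M ⊕ x    ≡⟨ cong (_⊕ x) (⊕-M b) ⟩
    b ⊕ x        ∎
    where open ≡-Reasoning

  infixl 6 _⊖_
  _⊖_ : Fin M → Fin M → ℕ
  q ⊖ b = (toℕ q + (M ∸ toℕ b)) % M

  ⊖<M : ∀ q b → q ⊖ b < M
  ⊖<M q b = m%n<n (toℕ q + (M ∸ toℕ b)) M

  ⊕-⊖ : ∀ b q → b ⊕ (q ⊖ b) ≡ q
  ⊕-⊖ b q = toℕ-injective (begin
    label b (q ⊖ b)                           ≡⟨ toℕ-⊕ b (q ⊖ b) ⟩
    (toℕ b + (toℕ q + (M ∸ toℕ b)) % M) % M   ≡⟨ cong (_% M) (+-comm (toℕ b) _) ⟩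
    ((toℕ q + (M ∸ toℕ b)) % M + toℕ b) % M   ≡⟨ %-absorbˡ (toℕ q + (M ∸ toℕ b)) (toℕ b) ⟩
    (toℕ q + (M ∸ toℕ b) + toℕ b) % M         ≡⟨ cong (_% M) (+-assoc (toℕ q) _ _) ⟩
    (toℕ q + (M ∸ toℕ b + toℕ b)) % M         ≡⟨ cong (λ z → (toℕ q + z) % M) (m∸n+n≡m (<⇒≤ (toℕ<n b))) ⟩
    (toℕ q + M) % M                           ≡⟨ [m+n]%n≡m%n (toℕ q) M ⟩
    toℕ q % M                                 ≡⟨ m<n⇒m%n≡m (toℕ<n q) ⟩
    toℕ q                                     ∎)
    where open ≡-Reasoning

  ⊖-⊕ : ∀ b {x} → x < M → b ⊕ x ⊖ b ≡ x
  ⊖-⊕ b {x} x<M = begin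
    (label b x + (M ∸ toℕ b)) % M           ≡⟨ cong (λ z → (z + (M ∸ toℕ b)) % M) (toℕ-⊕ b x) ⟩
    ((toℕ b + x) % M + (M ∸ toℕ b)) % M     ≡⟨ %-absorbˡ (toℕ b + x) (M ∸ toℕ b) ⟩
    (toℕ b + x + (M ∸ toℕ b)) % M           ≡⟨ cong (λ z → (z + (M ∸ toℕ b)) % M) (+-comm (toℕ b) x) ⟩
    (x + toℕ b + (M ∸ toℕ b)) % M           ≡⟨ cong (_% M) (+-assoc x (toℕ b) _) ⟩
    (x + (toℕ b + (M ∸ toℕ b))) % M         ≡⟨ cong (λ z → (x + z) % M) (m+[n∸m]≡n (<⇒≤ (toℕ<n b))) ⟩
    (x + M) % M                             ≡⟨ [m+n]%n≡m%n x M ⟩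
    x % M                                   ≡⟨ m<n⇒m%n≡m x<M ⟩
    x                                       ∎
    where open ≡-Reasoning

  ⊕-injective : ∀ b {x y} → x < M → y < M → b ⊕ x ≡ b ⊕ y → x ≡ y
  ⊕-injective b {x} {y} x<M y<M eq =
    trans (≡.sym (⊖-⊕ b x<M)) (trans (cong (_⊖ b) eq) (⊖-⊕ b y<M))

  label-injective : ∀ b {x y} → x < M → y < M → label b x ≡ label b y → x ≡ y
  label-injective b x<M y<M eq = ⊕-injective b x<M y<M (toℕ-injective eq)

  nextFin≡⊕1 : ∀ q → nextFin q ≡ q ⊕ 1
  nextFin≡⊕1 q with suc (toℕ q) <? M
  ... | yes q+1<M = toℕ-injective (begin
    toℕ (fromℕ< q+1<M)  ≡⟨ toℕ-fromℕ< q+1<M ⟩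
    suc (toℕ q)         ≡⟨ +-comm 1 (toℕ q) ⟩
    toℕ q + 1           ≡⟨ label-unwrapped q (subst (_< M) (+-comm 1 (toℕ q)) q+1<M) ⟨
    label q 1           ∎)
    where open ≡-Reasoning
  ... | no q+1≮M = toℕ-injective (≡.sym (begin
    label q 1          ≡⟨ toℕ-⊕ q 1 ⟩
    (toℕ q + 1) % M    ≡⟨ cong (_% M) (trans (+-comm (toℕ q) 1) (≤-antisym (toℕ<n q) (≮⇒≥ q+1≮M))) ⟩
    M % M              ≡⟨ n%n≡0 M ⟩
    0                  ∎))
    where open ≡-Reasoning

  label-<-unwrapped : ∀ b {x y} → x < y → toℕ b + y < M → label b x < label b y
  label-<-unwrapped b {x} {y} x<y b+y<M =
    subst₂ _<_ (≡.sym (label-unwrapped b b+x<M)) (≡.sym (label-unwrapped b b+y<M)) (+-monoʳ-< (toℕ b) x<y)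
    where
    b+x<M : toℕ b + x < M
    b+x<M = <-trans (+-monoʳ-< (toℕ b) x<y) b+y<M

  label-<-wrapped : ∀ b {x y} → x < y → y < M → M ≤ toℕ b + x → label b x < label b y
  label-<-wrapped b {x} {y} x<y y<M M≤b+x = +-cancelʳ-< M (label b x) (label b y)
    (subst₂ _<_ (≡.sym (label-wrapped b (<-trans x<y y<M) M≤b+x)) (≡.sym (label-wrapped b y<M M≤b+y))
      (+-monoʳ-< (toℕ b) x<y))
    where
    M≤b+y : M ≤ toℕ b + y
    M≤b+y = ≤-trans M≤b+x (+-monoʳ-≤ (toℕ b) (<⇒≤ x<y))

  label-<-across : ∀ b {x y} → y < M → M ≤ toℕ b + y → toℕ b + x < M → label b y < label b x
  label-<-across b {x} {y} y<M M≤b+y b+x<M = +-cancelʳ-< M (label b y) (label b x) (begin-strict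
    label b y + M  ≡⟨ label-wrapped b y<M M≤b+y ⟩
    toℕ b + y      <⟨ +-monoʳ-< (toℕ b) y<M ⟩
    toℕ b + M      ≤⟨ +-monoˡ-≤ M (m≤m+n (toℕ b) x) ⟩
    toℕ b + x + M  ≡⟨ cong (_+ M) (label-unwrapped b b+x<M) ⟨
    label b x + M  ∎)
    where open ≤-Reasoning

  label-≢ : ∀ b {x y} → x < y → y < M → label b x ≢ label b y
  label-≢ b x<y y<M eq = <⇒≢ x<y (label-injective b (<-trans x<y y<M) y<M eq)

  -- Split on where the rotation passes vertex 0: labels increase before and
  -- after that point, and those after it are the smaller ones.
  interleaved-chords-cross : ∀ b {α β γ δ} → α < β → β < γ → γ < δ → δ < M →
    ChordCross (label b α) (label b γ) (label b β) (label b δ)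
  interleaved-chords-cross b {α} {β} {γ} {δ} α<β β<γ γ<δ δ<M =
    label-≢ b α<β β<M , label-≢ b α<δ δ<M , ≡.≢-sym (label-≢ b β<γ γ<M) , label-≢ b γ<δ δ<M , interleave
    where
    γ<M = <-trans γ<δ δ<M
    β<M = <-trans β<γ γ<M
    α<γ = <-trans α<β β<γ
    α<δ = <-trans α<γ γ<δ
    β<δ = <-trans β<γ γ<δ
    B = toℕ b
    ℓ = label b
    lower : ∀ {x y} → x < y → B + y < M → B + x < M
    lower x<y = <-trans (+-monoʳ-< B x<y)
    interleave : (Btw (ℓ α) (ℓ γ) (ℓ β) × ¬ Btw (ℓ α) (ℓ γ) (ℓ δ)) ⊎
                 (¬ Btw (ℓ α) (ℓ γ) (ℓ β) × Btw (ℓ α) (ℓ γ) (ℓ δ))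
    interleave with B + δ <? M
    ... | yes δ↓ = inj₁ (btw-↑ (label-<-unwrapped b α<β (lower β<δ δ↓)) (label-<-unwrapped b β<γ (lower γ<δ δ↓)) ,
                         ¬btw-above (label-<-unwrapped b α<δ δ↓) (label-<-unwrapped b γ<δ δ↓))
    ... | no δ↑ with B + γ <? M
    ...   | yes γ↓ = inj₁ (btw-↑ (label-<-unwrapped b α<β (lower β<γ γ↓)) (label-<-unwrapped b β<γ γ↓) ,
                           ¬btw-below (label-<-across b δ<M (≮⇒≥ δ↑) (lower α<γ γ↓)) (label-<-across b δ<M (≮⇒≥ δ↑) γ↓))
    ...   | no γ↑ with B + β <? M
    ...     | yes β↓ = inj₂ (¬btw-above (label-<-unwrapped b α<β β↓) (label-<-across b γ<M (≮⇒≥ γ↑) β↓) ,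
                             btw-↓ (label-<-wrapped b γ<δ δ<M (≮⇒≥ γ↑)) (label-<-across b δ<M (≮⇒≥ δ↑) (lower α<β β↓)))
    ...     | no β↑ with B + α <? M
    ...       | yes α↓ = inj₂ (¬btw-below (label-<-across b β<M (≮⇒≥ β↑) α↓) (label-<-wrapped b β<γ γ<M (≮⇒≥ β↑)) ,
                               btw-↓ (label-<-wrapped b γ<δ δ<M (≮⇒≥ γ↑)) (label-<-across b δ<M (≮⇒≥ δ↑) α↓))
    ...       | no α↑ = inj₁ (btw-↑ (label-<-wrapped b α<β β<M (≮⇒≥ α↑)) (label-<-wrapped b β<γ γ<M (≮⇒≥ β↑)) ,
                             ¬btw-above (label-<-wrapped b α<δ δ<M (≮⇒≥ α↑)) (label-<-wrapped b γ<δ δ<M (≮⇒≥ γ↑)))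

  sum-rotate : ∀ (g : Fin M → ℕ) b → sum (map g (allFin M)) ≡ sumBelow (λ x → g (b ⊕ x)) M
  sum-rotate g b = begin
    sum (map g (allFin M))              ≡⟨ sum-map-allFin g ⟩
    sum (tabulate g)                    ≡⟨ sum-tabulate g f (λ i → cong g (≡.sym (0F⊕toℕ i))) ⟩
    sumBelow f M                        ≡⟨ cong (sumBelow f) B+C≡M ⟨
    sumBelow f (B + C)                  ≡⟨ sumBelow-rotate f B C periodic ⟨
    sumBelow (λ x → f (B + x)) (B + C)  ≡⟨ cong (sumBelow (λ x → f (B + x))) B+C≡M ⟩
    sumBelow (λ x → f (B + x)) M        ≡⟨⟩
    sumBelow (λ x → g (b ⊕ x)) M        ∎
    where
    open ≡-Reasoning
    f : ℕ → ℕ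
    f x = g (0F ⊕ x)
    B = toℕ b
    C = M ∸ B
    B+C≡M : B + C ≡ M
    B+C≡M = m+[n∸m]≡n (<⇒≤ (toℕ<n b))
    0F⊕toℕ : ∀ i → 0F ⊕ toℕ i ≡ i
    0F⊕toℕ i = toℕ-injective (label-unwrapped 0F (toℕ<n i))
    periodic : ∀ x → f (B + C + x) ≡ f x
    periodic x = cong g (trans (cong (λ z → 0F ⊕ (z + x)) B+C≡M) (⊕-periodic 0F x))

module Wheel (h : ℕ) where

  open Rotation (h + h) public

  h<M : h < M
  h<M = s≤s (m≤m+n h h)

  twice-span<M : ∀ {a c} → a ≤ c → c ≤ a + h → 2 * ∣ a - c ∣ < M
  twice-span<M {a} {c} a≤c c≤a+h = subst (λ d → 2 * d < M) (≡.sym (m≤n⇒∣m-n∣≡n∸m a≤c)) (twice d≤h)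
    where
    d≤h : c ∸ a ≤ h
    d≤h = m≤n+o⇒m∸n≤o c a c≤a+h
    twice : ∀ {d} → d ≤ h → 2 * d < M
    twice {d} d≤h = s≤s (+-mono-≤ d≤h (subst (_≤ h) (≡.sym (+-identityʳ d)) d≤h))

  M<twice-span : ∀ {a c} → c + suc h ≤ a → M < 2 * ∣ a - c ∣
  M<twice-span {a} {c} c+h<a = subst (λ d → M < 2 * d) (≡.sym (m≤n⇒∣n-m∣≡n∸m c≤a)) (twice h<d)
    where
    c≤a : c ≤ a
    c≤a = ≤-trans (m≤m+n c (suc h)) c+h<a
    h<d : h < a ∸ c
    h<d = m+n≤o⇒m≤o∸n (suc h) (subst (_≤ a) (+-comm c (suc h)) c+h<a)
    twice : ∀ {d} → h < d → M < 2 * d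
    twice {d} h<d = subst (_≤ 2 * d) (cong suc (+-suc h h))
      (+-mono-≤ h<d (subst (suc h ≤_) (≡.sym (+-identityʳ d)) h<d))

  radial-crosses-short-chord : ∀ b {α β γ} → α < β → β < γ → γ < M → γ ≤ α + h →
    RadCross M (label b β) (label b α) (label b γ)
  radial-crosses-short-chord b {α} {β} {γ} α<β β<γ γ<M γ≤α+h =
    ≡.≢-sym (label-≢ b α<β β<M) , label-≢ b β<γ γ<M , crossing
    where
    β<M = <-trans β<γ γ<M
    α<M = <-trans α<β β<M
    α<γ = <-trans α<β β<γ
    B = toℕ b
    ℓ = label b
    B+γ≤B+α+h : B + γ ≤ B + α + h
    B+γ≤B+α+h = ≤-trans (+-monoʳ-≤ B γ≤α+h) (≤-reflexive (≡.sym (+-assoc B α h)))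
    crossing : (2 * ∣ ℓ α - ℓ γ ∣ < M × Btw (ℓ α) (ℓ γ) (ℓ β)) ⊎
               (M < 2 * ∣ ℓ α - ℓ γ ∣ × ¬ Btw (ℓ α) (ℓ γ) (ℓ β))
    crossing with B + γ <? M | B + α <? M
    ... | yes γ↓ | _ = inj₁ (twice-span<M (<⇒≤ (label-<-unwrapped b α<γ γ↓)) ℓγ≤ℓα+h ,
                            btw-↑ (label-<-unwrapped b α<β β↓) (label-<-unwrapped b β<γ γ↓))
      where
      β↓ = <-trans (+-monoʳ-< B β<γ) γ↓
      α↓ = <-trans (+-monoʳ-< B α<β) β↓
      ℓγ≤ℓα+h : ℓ γ ≤ ℓ α + h
      ℓγ≤ℓα+h = begin
        ℓ γ        ≡⟨ label-unwrapped b γ↓ ⟩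
        B + γ      ≤⟨ B+γ≤B+α+h ⟩
        B + α + h  ≡⟨ cong (_+ h) (label-unwrapped b α↓) ⟨
        ℓ α + h    ∎
        where open ≤-Reasoning
    ... | no γ↑ | no α↑ = inj₁ (twice-span<M (<⇒≤ (label-<-wrapped b α<γ γ<M (≮⇒≥ α↑))) ℓγ≤ℓα+h ,
                               btw-↑ (label-<-wrapped b α<β β<M (≮⇒≥ α↑)) (label-<-wrapped b β<γ γ<M β↑))
      where
      β↑ = ≤-trans (≮⇒≥ α↑) (+-monoʳ-≤ B (<⇒≤ α<β))
      ℓγ≤ℓα+h : ℓ γ ≤ ℓ α + h
      ℓγ≤ℓα+h = +-cancelʳ-≤ M (ℓ γ) (ℓ α + h) (begin
        ℓ γ + M      ≡⟨ label-wrapped b γ<M (≮⇒≥ γ↑) ⟩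
        B + γ        ≤⟨ B+γ≤B+α+h ⟩
        B + α + h    ≡⟨ cong (_+ h) (label-wrapped b α<M (≮⇒≥ α↑)) ⟨
        ℓ α + M + h  ≡⟨ xy∙z≈xz∙y (ℓ α) M h ⟩
        ℓ α + h + M  ∎)
        where open ≤-Reasoning
    ... | no γ↑ | yes α↓ = inj₂ (M<twice-span ℓγ+h<ℓα , β-outside)
      where
      ℓγ+h<ℓα : ℓ γ + suc h ≤ ℓ α
      ℓγ+h<ℓα = +-cancelʳ-≤ h (ℓ γ + suc h) (ℓ α) (begin
        ℓ γ + suc h + h  ≡⟨ +-assoc (ℓ γ) (suc h) h ⟩
        ℓ γ + M          ≡⟨ label-wrapped b γ<M (≮⇒≥ γ↑) ⟩
        B + γ            ≤⟨ B+γ≤B+α+h ⟩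
        B + α + h        ≡⟨ cong (_+ h) (label-unwrapped b α↓) ⟨
        ℓ α + h          ∎)
        where open ≤-Reasoning
      β-outside : ¬ Btw (ℓ α) (ℓ γ) (ℓ β)
      β-outside with B + β <? M
      ... | yes β↓ = ¬btw-above (label-<-unwrapped b α<β β↓) (label-<-across b γ<M (≮⇒≥ γ↑) β↓)
      ... | no β↑ = ¬btw-below (label-<-across b β<M (≮⇒≥ β↑) α↓) (label-<-wrapped b β<γ γ<M (≮⇒≥ β↑))

module _ {m : ℕ} (G : Graph m) where

  Adj-sym : ∀ {p q} → Adj G p q → Adj G q p
  Adj-sym {p} {q} p~q = trans (Graph.sym G q p) p~q

  ¬Adj-refl : ∀ {p} → ¬ Adj G p p
  ¬Adj-refl {p} p~p with trans (≡.sym p~p) (Graph.irrefl G p)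
  ... | ()

  Boundary : Fin m → Set
  Boundary q = Adj G (rim q) (rim (nextFin q))

  rim-neighbour : Connected G → ∀ i → ∃[ p ] Adj G (rim i) p
  rim-neighbour connected i with connected (rim i) ctr
  ... | step i~p _ = _ , i~p

  last-rim-vertex : ∀ {u} → Walk G (rim u) ctr →
    ∃[ v ] Adj G ctr (rim v) × (v ≡ u ⊎ ∃[ q ] Adj G (rim v) (rim q))
  last-rim-vertex {u} (step {v = ctr}   u~x _)    = u , Adj-sym u~x , inj₁ refl
  last-rim-vertex {u} (step {v = rim w} u~w walk) with last-rim-vertex walk
  ... | v , x~v , inj₁ refl      = v , x~v , inj₂ (u , Adj-sym u~w)
  ... | v , x~v , inj₂ v~q       = v , x~v , inj₂ v~q

module PlaneConnected (h : ℕ) (T : Graph (suc (h + h))) (connected : Connected T) (plane : IsPlane T) where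

  open Wheel h

  Radial : Fin M → ℕ → Set
  Radial b x = Adj T ctr (rim (b ⊕ x))

  RimNeighbour : Fin M → ℕ → Set
  RimNeighbour b x = ∃[ y ] y < M × Adj T (rim (b ⊕ x)) (rim (b ⊕ y))

  boundary-at : ∀ a i → Adj T (rim (a ⊕ i)) (rim (a ⊕ suc i)) → Boundary T (a ⊕ i)
  boundary-at a i = subst (λ q → Adj T (rim (a ⊕ i)) (rim q)) (≡.sym next≡)
    where
    next≡ : nextFin (a ⊕ i) ≡ a ⊕ suc i
    next≡ = trans (nextFin≡⊕1 (a ⊕ i)) (trans (⊕-+ a i 1) (cong (a ⊕_) (+-comm i 1)))

  as-rim-neighbour : ∀ b {x} q → Adj T (rim (b ⊕ x)) (rim q) → RimNeighbour b x
  as-rim-neighbour b {x} q x~q = q ⊖ b , ⊖<M q b , subst (λ r → Adj T (rim (b ⊕ x)) (rim r)) (≡.sym (⊕-⊖ b q)) x~q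

  radial-or-rim-neighbour : ∀ b x → Radial b x ⊎ RimNeighbour b x
  radial-or-rim-neighbour b x with rim-neighbour T connected (b ⊕ x)
  ... | ctr   , x~ctr = inj₁ (Adj-sym T x~ctr)
  ... | rim q , x~q   = inj₂ (as-rim-neighbour b q x~q)

  short-chord-boundary : ∀ d a → 0 < d → d ≤ h → Adj T (rim a) (rim (a ⊕ d)) →
                         ∃[ i ] i < d × Boundary T (a ⊕ i)
  short-chord-boundary d a 0<d d≤h chord =
    go d (<-wellFounded d) a 0<d d≤h (subst (λ p → Adj T (rim p) (rim (a ⊕ d))) (≡.sym (⊕-identityʳ a)) chord)
    where
    go : ∀ d → Acc _<_ d → ∀ a → 0 < d → d ≤ h → Adj T (rim (a ⊕ 0)) (rim (a ⊕ d)) →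
         ∃[ i ] i < d × Boundary T (a ⊕ i)
    go (suc zero) _ a _ _ chord = 0 , s≤s z≤n , boundary-at a 0 chord
    go d@(suc (suc _)) (acc shorter) a _ d≤h chord with radial-or-rim-neighbour a 1
    ... | inj₁ radial = ⊥-elim (plane ctr (rim (a ⊕ 1)) (rim (a ⊕ 0)) (rim (a ⊕ d)) radial chord
                          (radial-crosses-short-chord a (s≤s z≤n) (s≤s (s≤s z≤n)) (≤-<-trans d≤h h<M) d≤h))
    ... | inj₂ (zero , _ , 1~0) = 0 , s≤s z≤n , boundary-at a 0 (Adj-sym T 1~0)
    ... | inj₂ (suc zero , _ , 1~1) = ⊥-elim (¬Adj-refl T 1~1)
    ... | inj₂ (j@(suc (suc j′)) , j<M , 1~j) with j ≤? d
    ...   | no j≰d = ⊥-elim (plane (rim (a ⊕ 0)) (rim (a ⊕ d)) (rim (a ⊕ 1)) (rim (a ⊕ j)) chord 1~j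
                        (interleaved-chords-cross a (s≤s z≤n) (s≤s (s≤s z≤n)) (≰⇒> j≰d) j<M))
    ...   | yes j≤d with go (suc j′) (shorter j≤d) (a ⊕ 1) (s≤s z≤n) (≤-trans (n≤1+n _) (≤-trans j≤d d≤h))
                       (subst₂ (λ p q → Adj T (rim p) (rim q)) (≡.sym (⊕-+ a 1 0)) (≡.sym (⊕-+ a 1 (suc j′))) 1~j)
    ...     | i , i<j-1 , boundary = suc i , s≤s (<-≤-trans i<j-1 (≤-pred j≤d)) , subst (Boundary T) (⊕-+ a 1 i) boundary

  short-side-boundary : ∀ b x d → 0 < d → d ≤ h → Adj T (rim (b ⊕ x)) (rim (b ⊕ (x + d))) →
                        ∃[ i ] i < d × Boundary T (b ⊕ (x + i))
  short-side-boundary b x d 0<d d≤h chord =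
    let (i , i<d , boundary) = short-chord-boundary d (b ⊕ x) 0<d d≤h chord′
    in i , i<d , subst (Boundary T) (⊕-+ b x i) boundary
    where
    chord′ = subst (λ p → Adj T (rim (b ⊕ x)) (rim p)) (≡.sym (⊕-+ b x d)) chord

  -- A long chord is a short chord read backwards, from b ⊕ (x + d) around past 0 to b ⊕ x.
  long-side-boundary : ∀ b x d → h < d → x + d < M → Adj T (rim (b ⊕ x)) (rim (b ⊕ (x + d))) →
                       ∃[ i ] i < M ∸ d × Boundary T (b ⊕ (x + d + i))
  long-side-boundary b x d h<d x+d<M chord =
    let (i , i<e , boundary) = short-chord-boundary e (b ⊕ (x + d)) 0<e e≤h back
    in i , i<e , subst (Boundary T) (⊕-+ b (x + d) i) boundary
    where
    e = M ∸ d
    d<M : d < M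
    d<M = ≤-<-trans (m≤n+m d x) x+d<M
    0<e : 0 < e
    0<e = m<n⇒0<n∸m d<M
    e≤h : e ≤ h
    e≤h = subst (e ≤_) (m+n∸m≡n (suc h) h) (∸-monoʳ-≤ M h<d)
    around : b ⊕ (x + d) ⊕ e ≡ b ⊕ x
    around = begin
      b ⊕ (x + d) ⊕ e    ≡⟨ ⊕-+ b (x + d) e ⟩
      b ⊕ (x + d + e)    ≡⟨ cong (b ⊕_) (+-assoc x d e) ⟩
      b ⊕ (x + (d + e))  ≡⟨ cong (λ z → b ⊕ (x + z)) (m+[n∸m]≡n (<⇒≤ d<M)) ⟩
      b ⊕ (x + M)        ≡⟨ cong (b ⊕_) (+-comm x M) ⟩
      b ⊕ (M + x)        ≡⟨ ⊕-periodic b x ⟩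
      b ⊕ x              ∎
      where open ≡-Reasoning
    back : Adj T (rim (b ⊕ (x + d))) (rim (b ⊕ (x + d) ⊕ e))
    back = subst (λ p → Adj T (rim (b ⊕ (x + d))) (rim p)) (≡.sym around) (Adj-sym T chord)

  module AtMostOneBoundary (b : Fin M) (unique : ∀ q → Boundary T q → q ≡ b ⊕ h) where

    boundary-offset : ∀ {i} → i < M → Boundary T (b ⊕ i) → i ≡ h
    boundary-offset i<M boundary = ⊕-injective b i<M h<M (unique _ boundary)

    boundary-beyond-long-chord : ∀ x d i → h < d → x + d < M → i < M ∸ d → ¬ Boundary T (b ⊕ (x + d + i))
    boundary-beyond-long-chord x d i h<d x+d<M i<e boundary = [ unwrapped , wrapped ]′ (<-≤-connex (x + d + i) M)
      where
      unwrapped : x + d + i < M → ⊥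
      unwrapped x+d+i<M = <-irrefl (≡.sym (boundary-offset x+d+i<M boundary))
                            (<-≤-trans h<d (≤-trans (m≤n+m d x) (m≤m+n (x + d) i)))
      wrapped : M ≤ x + d + i → ⊥
      wrapped M≤ = <-asym x+d<M M<x+d
        where
        z = x + d + i ∸ M
        M+z≡ : M + z ≡ x + d + i
        M+z≡ = m+[n∸m]≡n M≤
        z<x : z < x
        z<x = +-cancelˡ-< M z x (begin-strict
          M + z          ≡⟨ M+z≡ ⟩
          x + d + i      ≡⟨ +-assoc x d i ⟩
          x + (d + i)    <⟨ +-monoʳ-< x (subst (d + i <_) (m+[n∸m]≡n (<⇒≤ (≤-<-trans (m≤n+m d x) x+d<M))) (+-monoʳ-< d i<e)) ⟩
          x + M          ≡⟨ +-comm x M ⟩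
          M + x          ∎)
          where open ≤-Reasoning
        h<x : h < x
        h<x = subst (_< x) (boundary-offset (<-trans z<x (≤-<-trans (m≤m+n x d) x+d<M))
                (subst (Boundary T) (trans (cong (b ⊕_) (≡.sym M+z≡)) (⊕-periodic b z)) boundary)) z<x
        M<x+d : M < x + d
        M<x+d = subst (_≤ x + d) (cong suc (+-suc h h)) (+-mono-≤ h<x h<d)

    no-long-chord : ∀ x d → h < d → x + d < M → ¬ Adj T (rim (b ⊕ x)) (rim (b ⊕ (x + d)))
    no-long-chord x d h<d x+d<M chord =
      let (i , i<e , boundary) = long-side-boundary b x d h<d x+d<M chord
      in boundary-beyond-long-chord x d i h<d x+d<M i<e boundary

    chord-straddles : ∀ x d → 0 < d → x + d < M → Adj T (rim (b ⊕ x)) (rim (b ⊕ (x + d))) →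
                      x ≤ h × h < x + d × d ≤ h
    chord-straddles x d 0<d x+d<M chord = [ short , long ]′ (≤-<-connex d h)
      where
      short : d ≤ h → x ≤ h × h < x + d × d ≤ h
      short d≤h =
        let (i , i<d , boundary) = short-side-boundary b x d 0<d d≤h chord
            x+i≡h = boundary-offset (<-trans (+-monoʳ-< x i<d) x+d<M) boundary
        in subst (x ≤_) x+i≡h (m≤m+n x i) , subst (_< x + d) x+i≡h (+-monoʳ-< x i<d) , d≤h
      long : h < d → x ≤ h × h < x + d × d ≤ h
      long h<d = ⊥-elim (no-long-chord x d h<d x+d<M chord)

    ordered-chord-straddles : ∀ {x y} → x < y → y < M → Adj T (rim (b ⊕ x)) (rim (b ⊕ y)) →
                              x ≤ h × h < y × y ≤ x + h
    ordered-chord-straddles {x} {y} x<y y<M chord =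
      let (x≤h , h<y , d≤h) = chord-straddles x (y ∸ x) (m<n⇒0<n∸m x<y) (subst (_< M) (≡.sym x+d≡y) y<M)
                                (subst (λ z → Adj T (rim (b ⊕ x)) (rim (b ⊕ z))) (≡.sym x+d≡y) chord)
      in x≤h , subst (h <_) x+d≡y h<y , subst (_≤ x + h) x+d≡y (+-monoʳ-≤ x d≤h)
      where
      x+d≡y : x + (y ∸ x) ≡ y
      x+d≡y = m+[n∸m]≡n (<⇒≤ x<y)

    chord-window : ∀ {x y} → x < M → y < M → Adj T (rim (b ⊕ x)) (rim (b ⊕ y)) →
                   (x < y × x ≤ h × h < y × y ≤ x + h) ⊎ (y < x × y ≤ h × h < x × x ≤ y + h)
    chord-window {x} {y} x<M y<M chord with <-cmp x y
    ... | tri< x<y _ _    = inj₁ (x<y , ordered-chord-straddles x<y y<M chord)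
    ... | tri≈ _ refl _   = ⊥-elim (¬Adj-refl T chord)
    ... | tri> _ _ y<x    = inj₂ (y<x , ordered-chord-straddles y<x x<M (Adj-sym T chord))

    -- The chord at u ends in (h, u + h], the one at h + 1 + u starts in (u, h]: they interleave.
    ¬opposite-rim-neighbours : ∀ {u} → u < h → RimNeighbour b u → ¬ RimNeighbour b (suc h + u)
    ¬opposite-rim-neighbours {u} u<h (y , y<M , u~y) (x , x<M , v~x)
      with chord-window (<-trans u<h h<M) y<M u~y | chord-window (s≤s (+-monoʳ-< h u<h)) x<M v~x
    ... | inj₂ (_ , _ , h<u , _) | _                      = <-asym u<h h<u
    ... | inj₁ _                 | inj₁ (_ , v≤h , _ , _) = <-irrefl refl (≤-trans v≤h (m≤m+n h u))
    ... | inj₁ (u<y , _ , h<y , y≤u+h) | inj₂ (x<v , x≤h , _ , v≤x+h) =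
      plane (rim (b ⊕ u)) (rim (b ⊕ y)) (rim (b ⊕ x)) (rim (b ⊕ (suc h + u))) u~y (Adj-sym T v~x)
        (interleaved-chords-cross b u<x (≤-<-trans x≤h h<y) y<v v<M)
      where
      v<M : suc h + u < M
      v<M = s≤s (+-monoʳ-< h u<h)
      u<x : u < x
      u<x = +-cancelˡ-≤ h (suc u) x (subst₂ _≤_ (≡.sym (+-suc h u)) (+-comm x h) v≤x+h)
      y<v : y < suc h + u
      y<v = s≤s (subst (y ≤_) (+-comm u h) y≤u+h)

    rim-neighbour⇒opposite-radial : ∀ {u} → u < h → RimNeighbour b u → Radial b (suc h + u)
    rim-neighbour⇒opposite-radial {u} u<h u~y with radial-or-rim-neighbour b (suc h + u)
    ... | inj₁ radial = radial
    ... | inj₂ v~x    = ⊥-elim (¬opposite-rim-neighbours u<h u~y v~x)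

    opposite-rim-neighbour⇒radial : ∀ {u} → u < h → RimNeighbour b (suc h + u) → Radial b u
    opposite-rim-neighbour⇒radial {u} u<h v~x with radial-or-rim-neighbour b u
    ... | inj₁ radial = radial
    ... | inj₂ u~y    = ⊥-elim (¬opposite-rim-neighbours u<h u~y v~x)

    opposite-radial : ∀ {u} → u < h → Radial b u ⊎ Radial b (suc h + u)
    opposite-radial {u} u<h with radial-or-rim-neighbour b u
    ... | inj₁ radial = inj₁ radial
    ... | inj₂ u~y    = inj₂ (rim-neighbour⇒opposite-radial u<h u~y)

    RadialPair : Set
    RadialPair = ∃[ u ] u < h × Radial b u × Radial b (suc h + u)

    radial-with-rim-neighbour : ∀ {w} → w < M → Radial b w → RimNeighbour b w → RadialPair ⊎ w ≡ h
    radial-with-rim-neighbour {w} w<M radial w~ with <-cmp w h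
    ... | tri≈ _ w≡h _ = inj₂ w≡h
    ... | tri< w<h _ _ = inj₁ (w , w<h , radial , rim-neighbour⇒opposite-radial w<h w~)
    ... | tri> _ _ h<w = inj₁ (u , u<h , opposite-rim-neighbour⇒radial u<h (subst (RimNeighbour b) (≡.sym w≡) w~) ,
                                subst (Radial b) (≡.sym w≡) radial)
      where
      u = w ∸ suc h
      w≡ : suc h + u ≡ w
      w≡ = m+[n∸m]≡n h<w
      u<h : u < h
      u<h = +-cancelˡ-< (suc h) u h (subst (_< M) (≡.sym w≡) w<M)

    -- Look at the last rim vertex on a path from b ⊕ h to the centre.
    extra-radial : RadialPair ⊎ Radial b h
    extra-radial with last-rim-vertex T (connected (rim (b ⊕ h)) ctr)
    ... | v , radial , inj₁ refl      = inj₂ radial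
    ... | v , radial , inj₂ (q , v~q) =
      Sum.map₂ (λ w≡h → subst (Radial b) w≡h radial-w)
        (radial-with-rim-neighbour (⊖<M v b) radial-w (as-rim-neighbour b q w~q))
      where
      v≡b⊕w : v ≡ b ⊕ (v ⊖ b)
      v≡b⊕w = ≡.sym (⊕-⊖ b v)
      radial-w : Radial b (v ⊖ b)
      radial-w = subst (λ p → Adj T ctr (rim p)) v≡b⊕w radial
      w~q : Adj T (rim (b ⊕ (v ⊖ b))) (rim q)
      w~q = subst (λ p → Adj T (rim p) (rim q)) v≡b⊕w v~q

    radial# : ℕ → ℕ
    radial# x = b2n (E T ctr (rim (b ⊕ x)))

    many-radial : suc h ≤ sumBelow radial# M
    many-radial = sumBelow-opposite-pairs radial# h pair≥1 extra
      where
      one : ∀ {x} → Radial b x → radial# x ≡ 1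
      one = cong b2n
      pair≥1 : ∀ {u} → u < h → 1 ≤ radial# u + radial# (suc h + u)
      pair≥1 u<h with opposite-radial u<h
      ... | inj₁ radial = ≤-trans (≤-reflexive (≡.sym (one radial))) (m≤m+n _ _)
      ... | inj₂ radial = ≤-trans (≤-reflexive (≡.sym (one radial))) (m≤n+m _ _)
      extra : (∃[ w ] w < h × 2 ≤ radial# w + radial# (suc h + w)) ⊎ 1 ≤ radial# h
      extra with extra-radial
      ... | inj₁ (w , w<h , radial-u , radial-v) = inj₁ (w , w<h , ≤-reflexive (≡.sym (cong₂ _+_ (one radial-u) (one radial-v))))
      ... | inj₂ radial = inj₂ (≤-reflexive (≡.sym (one radial)))

  at-most-one-boundary⇒many-radial : ∀ p → (∀ q → Boundary T q → q ≡ p) → suc h ≤ radialCount T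
  at-most-one-boundary⇒many-radial p unique =
    subst (suc h ≤_) (≡.sym (sum-rotate (λ i → b2n (E T ctr (rim i))) b)) many-radial
    where
    b = p ⊕ suc h
    b⊕h≡p : b ⊕ h ≡ p
    b⊕h≡p = trans (⊕-+ p (suc h) h) (⊕-M p)
    open AtMostOneBoundary b (λ q boundary → trans (unique q boundary) (≡.sym b⊕h≡p))

two-or-at-most-one : ∀ {m} {P : Fin (suc m) → Set} → Decidable P →
  (∃[ i ] ∃[ j ] i ≢ j × P i × P j) ⊎ (∃[ p ] ∀ q → P q → q ≡ p)
two-or-at-most-one {P = P} P? with any? P?
... | no ∄P = inj₂ (0F , λ q Pq → ⊥-elim (∄P (q , Pq)))
... | yes (p , Pp) with any? (λ q → ¬? (q Fin.≟ p) ×-dec P? q)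
...   | yes (q , q≢p , Pq) = inj₁ (q , p , q≢p , Pq , Pp)
...   | no ∄other = inj₂ (p , only-p)
  where
  only-p : ∀ q → P q → q ≡ p
  only-p q Pq with q Fin.≟ p
  ... | yes q≡p = q≡p
  ... | no q≢p  = ⊥-elim (∄other (q , q≢p , Pq))

two-boundary-edges : ∀ {m} (G : Graph m) {i j} → i ≢ j → Boundary G i → Boundary G j → 2 ≤ boundaryCount G
two-boundary-edges {m} G {i} {j} i≢j boundary-i boundary-j =
  subst (2 ≤_) (≡.sym (sum-map-allFin g)) (subst (_≤ sum (tabulate g)) (cong₂ _+_ (cong b2n boundary-i) (cong b2n boundary-j))
    (sum-tabulate-≥-pair g i≢j))
  where
  g : Fin m → ℕ
  g q = b2n (E G (rim q) (rim (nextFin q)))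

few-radial⇒two-boundary : ∀ h (T : Graph (suc (h + h))) → Connected T → IsPlane T →
                          radialCount T ≤ h → 2 ≤ boundaryCount T
few-radial⇒two-boundary h T connected plane few
  with two-or-at-most-one (λ q → E T (rim q) (rim (nextFin q)) Bool.≟ true)
... | inj₁ (i , j , i≢j , boundary-i , boundary-j) = two-boundary-edges T i≢j boundary-i boundary-j
... | inj₂ (p , unique) =
  ⊥-elim (<⇒≱ (PlaneConnected.at-most-one-boundary⇒many-radial h T connected plane p unique) few)

proposition3 : (n : ℕ) → 2 ≤ n → (T : Graph (2 * n ∸ 1)) →
    IsSpanningTree T → IsPlane T →
    (k : ℕ) → radialCount T ≡ k → k < n →
    2 ≤ boundaryCount T
proposition3 (suc h) _ T (connected , _) plane _ refl k<n =
  subst (λ m → (T : Graph m) → Connected T → IsPlane T → radialCount T ≤ h → 2 ≤ boundaryCount T)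
    (≡.sym 2[1+h]∸1≡1+2h) (few-radial⇒two-boundary h) T connected plane (≤-pred k<n)
  where
  2[1+h]∸1≡1+2h : 2 * suc h ∸ 1 ≡ suc (h + h)
  2[1+h]∸1≡1+2h = trans (+-suc h (h + 0)) (cong (λ z → suc (h + z)) (+-identityʳ h))
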